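{- Let $G$ be a finite digraph containing a directed cycle $v_1\to v_2\to\dots\to v_m\to v_1$ with $m$ odd, and let $P$ be a poset with $|P|<3$. Then for every $k\ge 1$, there is no $P$-coloring of the $k$-walks of $G$.
   Context: A digraph has finite vertex set and edges that are ordered pairs of distinct vertices; write $u\to v$ for an edge. A $k$-walk is a sequence $(v_1\dots v_k)$ with $v_1\to\dots\to v_k$. A $P$-coloring of the $k$-walks is a map $c$ from $k$-walks to $P$ with $c(v_1\dots v_k)\not\le c(v_2\dots v_{k+1})$ for every $(k+1)$-walk $(v_1\dots v_{k+1})$. -}

module Defs where

open import Level using (Level)
open import Data.Nat using (ℕ; zero; suc; _<_; _≤_; _*_; _+_)
open import Data.Fin using (Fin; inject₁; fromℕ<) renaming (suc to fsuc; zero to fzero)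
open import Data.Nat.DivMod using (_mod_)
open import Data.Product using (Σ; ∃; _×_; _,_)
open import Data.Bool using (Bool; true; false; _∧_)
open import Data.Vec using (Vec; []; _∷_)
open import Data.Empty using (⊥)
open import Relation.Nullary using (¬_)
open import Relation.Binary.PropositionalEquality using (_≡_; refl)
open import Relation.Binary.Bundles using (Poset)
open import Function.Definitions using (Injective)

record Digraph : Set₁ where
  field
    n        : ℕ
    edge     : Fin n → Fin n → Bool
    loopless : ∀ v → edge v v ≡ false

open Digraph public

Edge : (G : Digraph) → Fin (n G) → Fin (n G) → Set
Edge G u v = edge G u v ≡ true

Vertex : Digraph → Set
Vertex G = Fin (n G)

isWalk : ∀ (G : Digraph) {k} → Vec (Vertex G) k → Bool
isWalk G []           = true
isWalk G (u ∷ [])     = true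
isWalk G (u ∷ v ∷ vs) = edge G u v ∧ isWalk G (v ∷ vs)

-- A k-walk of G: a vertex sequence of length k with consecutive edges
-- (the validity proof is an equation in Bool, hence proof-irrelevant).
Walk : Digraph → ℕ → Set
Walk G k = Σ (Vec (Vertex G) k) λ vs → isWalk G vs ≡ true

dropLast : ∀ {A : Set} {k} → Vec A (suc k) → Vec A k
dropLast (x ∷ [])     = []
dropLast (x ∷ y ∷ xs) = x ∷ dropLast (y ∷ xs)

private
  ∧-r : ∀ {a b} → a ∧ b ≡ true → b ≡ true
  ∧-r {true} p = p
  ∧-r {false} ()

  ∧-l : ∀ {a b} → a ∧ b ≡ true → a ≡ true
  ∧-l {true} p = refl
  ∧-l {false} ()

  ∧-i : ∀ {a b} → a ≡ true → b ≡ true → a ∧ b ≡ true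
  ∧-i refl p = p

  init-ok : ∀ G {k} (vs : Vec (Vertex G) (suc k)) →
            isWalk G vs ≡ true → isWalk G (dropLast vs) ≡ true
  init-ok G (u ∷ []) p = refl
  init-ok G (u ∷ v ∷ []) p = refl
  init-ok G (u ∷ v ∷ w ∷ vs) p =
    ∧-i (∧-l {edge G u v} p) (init-ok G (v ∷ w ∷ vs) (∧-r {edge G u v} p))

  tail-ok : ∀ G {k} (vs : Vec (Vertex G) (suc k)) →
            isWalk G vs ≡ true → isWalk G (Data.Vec.tail vs) ≡ true
  tail-ok G (u ∷ []) p = refl
  tail-ok G (u ∷ v ∷ vs) p = ∧-r {edge G u v} p

initW : ∀ {G k} → Walk G (suc k) → Walk G k
initW {G} (vs , p) = dropLast vs , init-ok G vs p

tailW : ∀ {G k} → Walk G (suc k) → Walk G k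
tailW {G} (vs , p) = Data.Vec.tail vs , tail-ok G vs p

IsPColoring : ∀ {c ℓ₁ ℓ₂} (P : Poset c ℓ₁ ℓ₂) (G : Digraph) (k : ℕ) →
              (Walk G k → Poset.Carrier P) → Set ℓ₂
IsPColoring P G k col =
  ∀ (w : Walk G (suc k)) → ¬ (Poset._≤_ P (col (initW w)) (col (tailW w)))

HasCycleOfLength : Digraph → ℕ → Set
HasCycleOfLength G m =
  Σ (1 ≤ m) λ m≥1 →
  Σ (Fin m → Vertex G) λ v →
    Injective _≡_ _≡_ v ×
    (∀ (i : Fin m) →
       Edge G (v i) (v (fromℕ< (Data.Nat.DivMod.m%n<n (suc (Data.Fin.toℕ i)) m ⦃ nz m≥1 ⦄))))
  where
  nz : ∀ {m} → 1 ≤ m → Data.Nat.NonZero m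
  nz (Data.Nat.s≤s _) = _

-- Slide a window of length k around the odd cycle: this gives m k-walks W₀, …, W_{m-1},
-- W_m = W₀, in which each consecutive pair Wᵢ, Wᵢ₊₁ is the initial and final part of a
-- (k+1)-walk, so their colours are incomparable and in particular distinct.  With at
-- most two colours the colours must alternate, which is impossible around an odd cycle.
module Submission where

open import Defs
open import Axiom.UniquenessOfIdentityProofs using (module Decidable⇒UIP)
open import Data.Bool using (true; _∧_)
open import Data.Bool.Properties using () renaming (_≟_ to _≟ᵇ_)
open import Data.Empty using (⊥-elim)
open import Data.Fin using (Fin; toℕ) renaming (zero to fzero; suc to fsuc)
open import Data.Fin.Properties using (fromℕ<-cong; toℕ-fromℕ<)
open import Data.Nat using (ℕ; zero; suc; _≤_; _*_; _+_; _%_; NonZero)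
open import Data.Nat.DivMod using (_mod_; m%n%n≡m%n; %-distribˡ-+; [m+n]%n≡m%n)
open import Data.Nat.Properties using (*-suc)
open import Data.Product using (Σ; ∃; _,_)
open import Data.Vec using (Vec; []; _∷_)
open import Function using (_∘_)
open import Function.Definitions using (Injective)
open import Relation.Binary.Bundles using (Poset)
open import Relation.Binary.PropositionalEquality
  using (_≡_; _≢_; refl; sym; trans; cong; cong₂; subst; module ≡-Reasoning)
open import Relation.Nullary using (¬_)

Walk-≡ : ∀ {G k} {vs ws : Vec (Vertex G) k} {p q} → vs ≡ ws →
         _≡_ {A = Walk G k} (vs , p) (ws , q)
Walk-≡ {p = p} {q} refl = cong (_ ,_) (Decidable⇒UIP.≡-irrelevant _≟ᵇ_ p q)

[1+m%n]%n≡[1+m]%n : ∀ m n .{{_ : NonZero n}} → suc (m % n) % n ≡ suc m % n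
[1+m%n]%n≡[1+m]%n m n = begin
  (1 + m % n) % n          ≡⟨ %-distribˡ-+ 1 (m % n) n ⟩
  (1 % n + m % n % n) % n  ≡⟨ cong (λ r → (1 % n + r) % n) (m%n%n≡m%n m n) ⟩
  (1 % n + m % n) % n      ≡⟨ %-distribˡ-+ 1 m n ⟨
  (1 + m) % n              ∎
  where open ≡-Reasoning

x≢y≢z⇒x≡z : {x y z : Fin 2} → x ≢ y → y ≢ z → x ≡ z
x≢y≢z⇒x≡z {fzero}      {fzero}      x≢y _   = ⊥-elim (x≢y refl)
x≢y≢z⇒x≡z {fsuc fzero} {fsuc fzero} x≢y _   = ⊥-elim (x≢y refl)
x≢y≢z⇒x≡z {fzero}      {fsuc fzero} {fzero}      _ _   = refl
x≢y≢z⇒x≡z {fzero}      {fsuc fzero} {fsuc fzero} _ y≢z = ⊥-elim (y≢z refl)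
x≢y≢z⇒x≡z {fsuc fzero} {fzero}      {fsuc fzero} _ _   = refl
x≢y≢z⇒x≡z {fsuc fzero} {fzero}      {fzero}      _ y≢z = ⊥-elim (y≢z refl)

alternating⇒¬odd-return : (h : ℕ → Fin 2) → (∀ i → h i ≢ h (suc i)) →
                          ∀ j → h (suc (2 * j)) ≢ h 0
alternating⇒¬odd-return h alternating j odd-return =
  alternating (2 * j) (trans (even-return j) (sym odd-return))
  where
  even-return : ∀ j → h (2 * j) ≡ h 0
  even-return zero = refl
  even-return (suc j) rewrite *-suc 2 j =
    trans (sym (x≢y≢z⇒x≡z (alternating (2 * j)) (alternating (suc (2 * j)))))
          (even-return j)

module InfiniteWalk (G : Digraph) (w : ℕ → Vertex G)
                    (w-edge : ∀ i → Edge G (w i) (w (suc i))) where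

  segment : ℕ → (k : ℕ) → Vec (Vertex G) k
  segment i zero    = []
  segment i (suc k) = w i ∷ segment (suc i) k

  segment-isWalk : ∀ i k → isWalk G (segment i k) ≡ true
  segment-isWalk i zero          = refl
  segment-isWalk i (suc zero)    = refl
  segment-isWalk i (suc (suc k)) = cong₂ _∧_ (w-edge i) (segment-isWalk (suc i) (suc k))

  window : ℕ → (k : ℕ) → Walk G k
  window i k = segment i k , segment-isWalk i k

  dropLast-segment : ∀ i k → dropLast (segment i (suc k)) ≡ segment i k
  dropLast-segment i zero    = refl
  dropLast-segment i (suc k) = cong (w i ∷_) (dropLast-segment (suc i) k)

  initW-window : ∀ i k → initW (window i (suc k)) ≡ window i k
  initW-window i k = Walk-≡ (dropLast-segment i k)

  tailW-window : ∀ i k → tailW (window i (suc k)) ≡ window (suc i) k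
  tailW-window i k = Walk-≡ refl

  window-periodic : ∀ {p} → (∀ i → w (i + p) ≡ w i) → ∀ i k → window (i + p) k ≡ window i k
  window-periodic {p} periodic i k = Walk-≡ (segment-periodic i k)
    where
    segment-periodic : ∀ i k → segment (i + p) k ≡ segment i k
    segment-periodic i zero    = refl
    segment-periodic i (suc k) = cong₂ _∷_ (periodic i) (segment-periodic (suc i) k)

  window-colours-≉ : ∀ {c ℓ₁ ℓ₂} (P : Poset c ℓ₁ ℓ₂) {k} (col : Walk G k → Poset.Carrier P) →
                     IsPColoring P G k col →
                     ∀ i → ¬ Poset._≈_ P (col (window i k)) (col (window (suc i) k))
  window-colours-≉ P {k} col isColoring i c≈c′ = isColoring (window i (suc k)) c≤c′
    where
    c≤c′ : Poset._≤_ P (col (initW (window i (suc k)))) (col (tailW (window i (suc k))))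
    c≤c′ rewrite initW-window i k | tailW-window i k = Poset.reflexive P c≈c′

module CyclicSequence (G : Digraph) {m : ℕ} .{{_ : NonZero m}} (v : Fin m → Vertex G) where

  cyclic : ℕ → Vertex G
  cyclic i = v (i mod m)

  cyclic-edge : (∀ i → Edge G (v i) (v (suc (toℕ i) mod m))) →
                ∀ i → Edge G (cyclic i) (cyclic (suc i))
  cyclic-edge v-edge i = subst (Edge G (cyclic i) ∘ v) next≡ (v-edge (i mod m))
    where
    next≡ : suc (toℕ (i mod m)) mod m ≡ suc i mod m
    next≡ = fromℕ<-cong _ _
      (trans (cong (λ r → suc r % m) (toℕ-fromℕ< _)) ([1+m%n]%n≡[1+m]%n i m)) _ _

  cyclic-periodic : ∀ i → cyclic (i + m) ≡ cyclic i
  cyclic-periodic i = cong v (fromℕ<-cong _ _ ([m+n]%n≡m%n i m) _ _)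

mainTheorem10 : ∀ {c ℓ₁ ℓ₂} (G : Digraph) (m : ℕ) →
    (∃ λ j → m ≡ suc (2 * j)) → HasCycleOfLength G m →
    (P : Poset c ℓ₁ ℓ₂) →
    (Σ (Poset.Carrier P → Fin 2) λ f → Injective (Poset._≈_ P) _≡_ f) →
    (k : ℕ) → 1 ≤ k →
    ¬ (Σ (Walk G k → Poset.Carrier P) λ col → IsPColoring P G k col)
mainTheorem10 G .(suc (2 * j)) (j , refl) (_ , v , _ , v-edge) P (f , f-injective) k _
              (col , isColoring) =
  alternating⇒¬odd-return h h-alternating j h-returns
  where
  open CyclicSequence G v
  open InfiniteWalk G cyclic (cyclic-edge v-edge)

  h : ℕ → Fin 2
  h i = f (col (window i k))

  h-alternating : ∀ i → h i ≢ h (suc i)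
  h-alternating i = window-colours-≉ P col isColoring i ∘ f-injective

  h-returns : h (suc (2 * j)) ≡ h 0
  h-returns = cong (f ∘ col) (window-periodic {suc (2 * j)} cyclic-periodic 0 k)
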